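{- Let $w=1112122$, $w^*=1112^*122$ and $$j_1=m\left(\overline{212111112122}\,w^*\,w\,w\,121112\,\overline{221211111212}\right).$$ Suppose $B\in\{1,2\}^{\mathbb{Z}}$ satisfies $B=22\,w^*\,11$ and $m(B)<j_1$. Then $B=22\,w\,w^*\,w\,1$.
   Context: For a bi-infinite sequence $B=(b_n)_{n\in\mathbb{Z}}$ of positive integers, $\lambda_k(B)=[b_k;b_{k+1},\dots]+[0;b_{k-1},b_{k-2},\dots]$ and $m(B)=\sup_k\lambda_k(B)$. For a finite word $u=u_{ -p}\dots u_0^*\dots u_q$ with one starred letter, "$B=u$" means $(b_{ -p},\dots,b_q)=(u_{ -p},\dots,u_q)$. In the expression for $j_1$ the starred letter is at position $0$, an overline at the left end denotes the word repeated infinitely to the left and at the right end repeated infinitely to the right. -}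

module Defs where

open import Data.Nat as ℕ using (ℕ; zero; suc; _+_; _*_; _∸_; _%_; _<ᵇ_)
open import Data.Integer as ℤ using (ℤ; +_; -[1+_])
open import Data.Rational as ℚ using (ℚ; _/_; 0ℚ)
open import Data.List using (List; []; _∷_)
open import Data.Bool using (if_then_else_)
open import Data.Product using (_×_; _,_; ∃-syntax)
open import Data.Sum using (_⊎_)
open import Data.Unit using (⊤)
open import Relation.Binary.PropositionalEquality using (_≡_)

Seq : Set
Seq = ℤ → ℕ

IsBinary12 : Seq → Set
IsBinary12 B = ∀ (n : ℤ) → (B n ≡ 1) ⊎ (B n ≡ 2)

-- nth element of a list, default 0 (only used on in-range indices)
at : List ℕ → ℕ → ℕ
at []       _       = 0
at (a ∷ _)  zero    = a
at (_ ∷ as) (suc n) = at as n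

matchesFrom : Seq → List ℕ → ℤ → Set
matchesFrom B []      s = ⊤
matchesFrom B (a ∷ u) s = (B s ≡ a) × matchesFrom B u (ℤ.suc s)

fwd : Seq → ℤ → ℕ → List ℕ
fwd B k zero    = []
fwd B k (suc m) = B k ∷ fwd B (ℤ.suc k) m

bwd : Seq → ℤ → ℕ → List ℕ
bwd B k zero    = []
bwd B k (suc m) = B k ∷ bwd B (ℤ.pred k) m

-- finite continued fraction [a0;a1,…,an] = p / q, returned as (p , q);
-- cf [] = (1 , 0) encodes "∞", so that [0; ] = q/p = 0.
cf : List ℕ → ℕ × ℕ
cf []      = 1 , 0
cf (a ∷ r) with cf r
... | p , q = a * p + q , p

-- p / q as a rational (the q = 0 branch never occurs for positive entries)
frac : ℕ → ℕ → ℚ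
frac p zero    = 0ℚ
frac p (suc q) = (+ p) / suc q

cfVal : List ℕ → ℚ
cfVal l with cf l
... | p , q = frac p q

cfVal0 : List ℕ → ℚ
cfVal0 l with cf l
... | p , q = frac q p

-- Lower approximants of λ_k(B) = [b_k;b_{k+1},…] + [0;b_{k-1},b_{k-2},…]:
-- the even convergents [b_k;…,b_{k+2n}] and [0;b_{k-1},…,b_{k-2n}].
-- These increase strictly with n and converge to λ_k(B), so
-- λ_k(B) = sup_n lowerApprox B k n.
lowerApprox : Seq → ℤ → ℕ → ℚ
lowerApprox B k n =
  cfVal (fwd B k (suc (2 * n))) ℚ.+ cfVal0 (bwd B (ℤ.pred k) (2 * n))

-- m(B) < m(C), where m(X) = sup_k λ_k(X) = sup_{k,n} lowerApprox X k n:
-- there is a rational q with m(B) ≤ q < m(C).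
MarkovLess : Seq → Seq → Set
MarkovLess B C =
  ∃[ q ] ((∀ (k : ℤ) (n : ℕ) → lowerApprox B k n ℚ.≤ q)
          × (∃[ k ] ∃[ n ] (q ℚ.< lowerApprox C k n)))

w : List ℕ
w = 1 ∷ 1 ∷ 1 ∷ 2 ∷ 1 ∷ 2 ∷ 2 ∷ []

-- left periodic block 212111112122 (repeated infinitely to the left)
leftBlock : List ℕ
leftBlock = 2 ∷ 1 ∷ 2 ∷ 1 ∷ 1 ∷ 1 ∷ 1 ∷ 1 ∷ 2 ∷ 1 ∷ 2 ∷ 2 ∷ []

-- right periodic block 221211111212 (repeated infinitely to the right)
rightBlock : List ℕ
rightBlock = 2 ∷ 2 ∷ 1 ∷ 2 ∷ 1 ∷ 1 ∷ 1 ∷ 1 ∷ 1 ∷ 2 ∷ 1 ∷ 2 ∷ []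

-- central part  w* w w 121112, occupying positions -3 … 23
middle : List ℕ
middle = 1 ∷ 1 ∷ 1 ∷ 2 ∷ 1 ∷ 2 ∷ 2 ∷
         1 ∷ 1 ∷ 1 ∷ 2 ∷ 1 ∷ 2 ∷ 2 ∷
         1 ∷ 1 ∷ 1 ∷ 2 ∷ 1 ∷ 2 ∷ 2 ∷
         1 ∷ 2 ∷ 1 ∷ 1 ∷ 1 ∷ 2 ∷ []

-- The sequence  \overline{212111112122} w* w w 121112 \overline{221211111212}
-- with the starred letter of w* = 1112*122 at position 0:
--   positions -3 … 23 : middle
--   positions ≥ 24    : rightBlock repeated, starting at 24
--   positions ≤ -4    : leftBlock repeated, its last letter at -4
jSeq : Seq
jSeq (+ n) = if n <ᵇ 24 then at middle (n + 3) else at rightBlock ((n ∸ 24) % 12)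
jSeq -[1+ n ] = if n <ᵇ 3 then at middle (2 ∸ n) else at leftBlock (11 ∸ ((n ∸ 3) % 12))

{-# OPTIONS --safe #-}
module Submission where

-- Continued fractions with positive partial quotients compare
-- lexicographically with alternating orientation, so a finite window of B bounds some
-- λ_k(B) from below by a rational number; when m(B) < j₁, none of these bounds may
-- exceed a rational upper bound j₁⁺ of j₁. Exhausting the unknown letters around
-- 22 w* 11 in this way leaves two windows: 22 w w* w 1, which is the claim, and the
-- central window of the sequence S defining j₁. In the second case, follow B outwards
-- from the centre. At the first letter where B leaves S, either λ₀ increases, or it
-- decreases and then a search around the switched letter (periodic with period 12 far
-- from the centre) again exceeds j₁⁺. If λ₀ only ever increases, then λ₀(B) ≥ λ₀(S),
-- and λ₀(S) = j₁ because the other λ_k(S) are smaller (a finite check, again periodic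
-- with period 12); this contradicts m(B) < j₁.

open import Defs
open import Data.Bool using (Bool; true; false; not; if_then_else_; T; _∧_; _∨_)
open import Data.Bool.ListAction using (all)
open import Data.Bool.Properties using (T-∧; T-∨; T-≡)
open import Data.Empty using (⊥-elim)
open import Data.Integer as ℤ using (ℤ; +_; -[1+_]; -_)
import Data.Integer.Properties as ℤ
open import Data.List using (List; []; _∷_; _++_; _ʳ++_; length; drop; upTo)
open import Data.List.Membership.Propositional.Properties using (∈-upTo⁺)
open import Data.List.Properties using (++-identityʳ; ++-assoc; length-++; ∷-injectiveˡ; ∷-injectiveʳ; ≡-dec)
open import Data.List.Relation.Unary.All as All using (All; []; _∷_)
open import Data.List.Relation.Unary.All.Properties using (++⁺; ++⁻ʳ; all⁺)
open import Data.Nat using (ℕ; zero; suc; _+_; _*_; _∸_; _%_; _<ᵇ_; _≡ᵇ_; _≤_; _<_; z≤n; s≤s; _≟_; _<?_; NonZero; >-nonZero⁻¹)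
open import Data.Nat.DivMod using ([m+n]%n≡m%n; m%n<n)
open import Data.Nat.Induction using (<-rec)
open import Data.Nat.Properties
open import Data.Nat.Tactic.RingSolver using (solve-∀)
open import Data.Product using (_×_; _,_; proj₁; proj₂; ∃-syntax)
open import Data.Rational as ℚ using (ℚ)
import Data.Rational.Properties as ℚ
import Data.Rational.Unnormalised as ℚᵘ
import Data.Rational.Unnormalised.Properties as ℚᵘ
open import Data.Sum using (_⊎_; inj₁; inj₂)
open import Data.Unit using (tt)
open import Function using (_∘_; Equivalence)
open import Relation.Binary.Definitions using (DecidableEquality)
open import Relation.Binary.PropositionalEquality
open import Relation.Nullary using (Dec; yes; no; ¬_; contradiction)
open import Relation.Nullary.Decidable using (⌊_⌋; True; toWitness; _×-dec_; _⊎-dec_)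

-- Continued fractions

num den : List ℕ → ℕ
num l = proj₁ (cf l)
den l = proj₂ (cf l)

num-∷ : ∀ a l → num (a ∷ l) ≡ a * num l + den l
num-∷ a l with cf l
... | p , q = refl

den-∷ : ∀ a l → den (a ∷ l) ≡ num l
den-∷ a l with cf l
... | p , q = refl

cfVal-num-den : ∀ l → cfVal l ≡ frac (num l) (den l)
cfVal-num-den l with cf l
... | p , q = refl

cfVal0-∷ : ∀ l → cfVal0 l ≡ cfVal (0 ∷ l)
cfVal0-∷ l with cf l
... | p , q = refl

Positive : List ℕ → Set
Positive = All (1 ≤_)

num≤num-∷ : ∀ {a} l → 1 ≤ a → num l ≤ num (a ∷ l)
num≤num-∷ {suc a} l _ rewrite num-∷ (suc a) l =
  ≤-trans (m≤m+n (num l) (a * num l)) (m≤m+n _ (den l))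

num-pos : ∀ {l} → Positive l → 1 ≤ num l
num-pos []                    = s≤s z≤n
num-pos {x ∷ l} (1≤x ∷ pos-l) = ≤-trans (num-pos pos-l) (num≤num-∷ l 1≤x)

den-pos : ∀ a {l} → Positive l → 1 ≤ den (a ∷ l)
den-pos a {l} pos-l = subst (1 ≤_) (sym (den-∷ a l)) (num-pos pos-l)

den≤num : ∀ {l} → Positive l → den l ≤ num l
den≤num []                = z≤n
den≤num {x ∷ l} (1≤x ∷ _) = subst (_≤ num (x ∷ l)) (sym (den-∷ x l)) (num≤num-∷ l 1≤x)

num≤3*den : ∀ {c} l → c ≤ 2 → Positive l → num (c ∷ l) ≤ 3 * den (c ∷ l)
num≤3*den {c} l c≤2 pos-l rewrite num-∷ c l | den-∷ c l = begin
  c * num l + den l ≤⟨ +-mono-≤ (*-monoˡ-≤ (num l) c≤2) (den≤num pos-l) ⟩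
  2 * num l + num l ≡⟨ +-comm (2 * num l) (num l) ⟩
  3 * num l         ∎
  where open ≤-Reasoning

-- Comparison of [P] and [Q] as fractions num/den; [] stands for 1/0 = ∞.
record _≼_ (P Q : List ℕ) : Set where
  constructor mk≼
  field cross : num P * den Q ≤ num Q * den P

≼-∞ : ∀ P → P ≼ []
≼-∞ P = mk≼ (≤-trans (≤-reflexive (*-zeroʳ (num P))) z≤n)

∷-antimono-≼ : ∀ a {P Q} → Q ≼ P → (a ∷ P) ≼ (a ∷ Q)
∷-antimono-≼ a {P} {Q} (mk≼ Q≼P) = mk≼ (antimono (num-∷ a P) (num-∷ a Q) (den-∷ a P) (den-∷ a Q))
  where
  open ≤-Reasoning
  expand : ∀ a p d q → (a * p + d) * q ≡ a * p * q + q * d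
  expand = solve-∀
  regroup : ∀ a p d q → a * p * q + p * d ≡ (a * q + d) * p
  regroup = solve-∀
  antimono : ∀ {nP nQ dP dQ} → nP ≡ a * num P + den P → nQ ≡ a * num Q + den Q →
             dP ≡ num P → dQ ≡ num Q →
             nP * dQ ≤ nQ * dP
  antimono refl refl refl refl = begin
    (a * num P + den P) * num Q       ≡⟨ expand a (num P) (den P) (num Q) ⟩
    a * num P * num Q + num Q * den P ≤⟨ +-monoʳ-≤ (a * num P * num Q) Q≼P ⟩
    a * num P * num Q + num P * den Q ≡⟨ regroup a (num P) (den Q) (num Q) ⟩
    (a * num Q + den Q) * num P       ∎

-- Two-step recursion makes even (12 + n) and even n definitionally equal.
even : ℕ → Bool
even zero          = true
even (suc zero)    = false
even (suc (suc n)) = even n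

even-suc : ∀ n → even (suc n) ≡ not (even n)
even-suc zero          = refl
even-suc (suc zero)    = refl
even-suc (suc (suc n)) = even-suc n

even-2* : ∀ n → even (2 * n) ≡ true
even-2* zero    = refl
even-2* (suc n) rewrite *-suc 2 n = even-2* n

_≼[_]_ : List ℕ → Bool → List ℕ → Set
P ≼[ true  ] Q = P ≼ Q
P ≼[ false ] Q = Q ≼ P

++-mono-≼ : ∀ w {X Y} → X ≼[ even (length w) ] Y → (w ++ X) ≼ (w ++ Y)
++-mono-≼ []      X≼Y = X≼Y
++-mono-≼ (a ∷ w) {X} {Y} h =
  ∷-antimono-≼ a {w ++ X} {w ++ Y} (++-mono-≼ w (reorient (even (length w)) h′))
  where
  h′ : X ≼[ not (even (length w)) ] Y
  h′ = subst (X ≼[_] Y) (even-suc (length w)) h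
  reorient : ∀ b → X ≼[ not b ] Y → Y ≼[ b ] X
  reorient true  h = h
  reorient false h = h

≼⇒cfVal≤ : ∀ {P Q} → 1 ≤ den P → 1 ≤ den Q → P ≼ Q → cfVal P ℚ.≤ cfVal Q
≼⇒cfVal≤ {P} {Q} 1≤dP 1≤dQ (mk≼ P≼Q) rewrite cfVal-num-den P | cfVal-num-den Q = frac-mono 1≤dP 1≤dQ P≼Q
  where
  frac-mono : ∀ {a b c d} → 1 ≤ b → 1 ≤ d → a * d ≤ c * b → frac a b ℚ.≤ frac c d
  frac-mono {a} {suc b} {c} {suc d} _ _ ad≤cb = ℚ.toℚᵘ-cancel-≤
    (ℚᵘ.≤-respˡ-≃ (ℚᵘ.≃-sym (ℚ.toℚᵘ-fromℚᵘ (ℚᵘ.mkℚᵘ (+ a) b)))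
    (ℚᵘ.≤-respʳ-≃ (ℚᵘ.≃-sym (ℚ.toℚᵘ-fromℚᵘ (ℚᵘ.mkℚᵘ (+ c) d)))
    (ℚᵘ.*≤* (subst₂ ℤ._≤_ (ℤ.pos-* a (suc d)) (ℤ.pos-* c (suc b)) (ℤ.+≤+ ad≤cb)))))

TailPositive : List ℕ → Set
TailPositive w = Positive (drop 1 w)

den-++-pos : ∀ w {c v} → TailPositive w → 1 ≤ c → Positive v → 1 ≤ den (w ++ c ∷ v)
den-++-pos []      {c} _ 1≤c pos-v = den-pos c pos-v
den-++-pos (a ∷ w) pos-w 1≤c pos-v = den-pos a (++⁺ pos-w (1≤c ∷ pos-v))

cfVal-even-convergent≤ : ∀ a {w} v → Positive w → Positive v → even (length w) ≡ true →
                        cfVal (a ∷ w) ℚ.≤ cfVal (a ∷ w ++ v)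
cfVal-even-convergent≤ a {w} v pos-w pos-v ev =
  ≼⇒cfVal≤ (den-pos a pos-w) (den-pos a (++⁺ pos-w pos-v))
    (subst (λ u → (a ∷ u) ≼ (a ∷ w ++ v)) (++-identityʳ w) (++-mono-≼ (a ∷ w) {[]} {v} v≼∞))
  where
  v≼∞ : [] ≼[ even (suc (length w)) ] v
  v≼∞ rewrite even-suc (length w) | ev = ≼-∞ v

cfVal-odd-convergent≥ : ∀ a {w} v → Positive w → Positive v → even (length w) ≡ false →
                         cfVal (a ∷ w ++ v) ℚ.≤ cfVal (a ∷ w)
cfVal-odd-convergent≥ a {w} v pos-w pos-v ev =
  ≼⇒cfVal≤ (den-pos a (++⁺ pos-w pos-v)) (den-pos a pos-w)
    (subst (λ u → (a ∷ w ++ v) ≼ (a ∷ u)) (++-identityʳ w) (++-mono-≼ (a ∷ w) {v} {[]} v≼∞))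
  where
  v≼∞ : v ≼[ even (suc (length w)) ] []
  v≼∞ rewrite even-suc (length w) | ev = ≼-∞ v

Bin : ℕ → Set
Bin x = (x ≡ 1) ⊎ (x ≡ 2)

bin-pos : ∀ {x} → Bin x → 1 ≤ x
bin-pos (inj₁ refl) = s≤s z≤n
bin-pos (inj₂ refl) = s≤s z≤n

bin-swap : ∀ {x} → Bin x → Bin (3 ∸ x)
bin-swap (inj₁ refl) = inj₂ refl
bin-swap (inj₂ refl) = inj₁ refl

bin-other : ∀ {a b} → Bin a → Bin b → a ≢ b → b ≡ 3 ∸ a
bin-other (inj₁ refl) (inj₁ refl) a≢b = contradiction refl a≢b
bin-other (inj₁ refl) (inj₂ refl) _   = refl
bin-other (inj₂ refl) (inj₁ refl) _   = refl
bin-other (inj₂ refl) (inj₂ refl) a≢b = contradiction refl a≢b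

bin-positive : ∀ {l} → All Bin l → Positive l
bin-positive = All.map bin-pos

-- Since 1 ≤ [c; v] ≤ 3 for c ∈ {1, 2}, replacing the tail at depth p by minTail p can only
-- lower the continued fraction.
minTail : ℕ → ℕ
minTail p = if even p then 1 else 3

cfVal-minTail≤ : ∀ w {c v} → TailPositive w → Bin c → Positive v →
                 cfVal (w ++ minTail (length w) ∷ []) ℚ.≤ cfVal (w ++ c ∷ v)
cfVal-minTail≤ w {c} {v} tp bin-c pos-v =
  ≼⇒cfVal≤ (den-++-pos w tp (1≤minTail (even (length w))) []) (den-++-pos w tp (bin-pos bin-c) pos-v)
    (++-mono-≼ w (bound (even (length w))))
  where
  1≤minTail : ∀ b → 1 ≤ (if b then 1 else 3)
  1≤minTail true  = s≤s z≤n
  1≤minTail false = s≤s z≤n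
  bound : ∀ b → ((if b then 1 else 3) ∷ []) ≼[ b ] (c ∷ v)
  bound true  = mk≼ (subst₂ _≤_ (sym (*-identityˡ _)) (sym (*-identityʳ _)) (den≤num (bin-pos bin-c ∷ pos-v)))
  bound false = mk≼ (subst (_≤ 3 * den (c ∷ v)) (sym (*-identityʳ _)) (num≤3*den v (bin-≤2 bin-c) pos-v))
    where
    bin-≤2 : ∀ {x} → Bin x → x ≤ 2
    bin-≤2 (inj₁ refl) = s≤s z≤n
    bin-≤2 (inj₂ refl) = ≤-refl

1∷≼2∷ : ∀ {v} v′ → Positive v → (1 ∷ v) ≼ (2 ∷ v′)
1∷≼2∷ {v} v′ pos-v = mk≼ (cross (num-∷ 1 v) (num-∷ 2 v′) (den-∷ 1 v) (den-∷ 2 v′))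
  where
  open ≤-Reasoning
  double : ∀ x y → (1 * x + x) * y ≡ 2 * y * x
  double = solve-∀
  cross : ∀ {n₁ n₂ d₁ d₂} → n₁ ≡ 1 * num v + den v → n₂ ≡ 2 * num v′ + den v′ →
          d₁ ≡ num v → d₂ ≡ num v′ →
          n₁ * d₂ ≤ n₂ * d₁
  cross refl refl refl refl = begin
    (1 * num v + den v) * num v′  ≤⟨ *-monoˡ-≤ (num v′) (+-monoʳ-≤ (1 * num v) (den≤num pos-v)) ⟩
    (1 * num v + num v) * num v′  ≡⟨ double (num v) (num v′) ⟩
    2 * num v′ * num v            ≤⟨ *-monoˡ-≤ (num v) (m≤m+n (2 * num v′) (den v′)) ⟩
    (2 * num v′ + den v′) * num v ∎

-- Changing the letter at depth p away from maxLetter p lowers the continued fraction.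
maxLetter : ℕ → ℕ
maxLetter p = if even p then 2 else 1

cfVal-raise : ∀ w {a v v′} → TailPositive w → Bin a → a ≢ maxLetter (length w) →
              Positive v → Positive v′ → cfVal (w ++ a ∷ v) ℚ.≤ cfVal (w ++ (3 ∸ a) ∷ v′)
cfVal-raise w {a} {v} {v′} tp bin-a a≢max pos-v pos-v′ =
  ≼⇒cfVal≤ (den-++-pos w tp (bin-pos bin-a) pos-v) (den-++-pos w tp (bin-pos (bin-swap bin-a)) pos-v′)
    (++-mono-≼ w (raise (even (length w)) bin-a a≢max))
  where
  raise : ∀ b {a} → Bin a → a ≢ (if b then 2 else 1) → (a ∷ v) ≼[ b ] ((3 ∸ a) ∷ v′)
  raise true  (inj₁ refl) _   = 1∷≼2∷ v′ pos-v
  raise true  (inj₂ refl) a≢2 = contradiction refl a≢2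
  raise false (inj₁ refl) a≢1 = contradiction refl a≢1
  raise false (inj₂ refl) _   = 1∷≼2∷ v pos-v′

tailPositive-∷ʳ : ∀ w {a} → TailPositive w → 1 ≤ a → TailPositive (w ++ a ∷ [])
tailPositive-∷ʳ []      _     _   = []
tailPositive-∷ʳ (_ ∷ w) pos-w 1≤a = ++⁺ pos-w (1≤a ∷ [])

LoweringSwitch : List ℕ → List ℕ → List ℕ → Set
LoweringSwitch w A B =
  ∃[ u ] ∃[ a ] ∃[ v ] ∃[ v′ ]
    (A ≡ u ++ a ∷ v × B ≡ u ++ (3 ∸ a) ∷ v′ × a ≡ maxLetter (length w + length u))

cfVal-≤⊎loweringSwitch : ∀ w {A B} → TailPositive w → All Bin A → All Bin B → length A ≡ length B →
                         cfVal (w ++ A) ℚ.≤ cfVal (w ++ B) ⊎ LoweringSwitch w A B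
cfVal-≤⊎loweringSwitch w {[]}    {[]}    _  _           _           _   = inj₁ ℚ.≤-refl
cfVal-≤⊎loweringSwitch w {[]}    {_ ∷ _} _  _           _           ()
cfVal-≤⊎loweringSwitch w {_ ∷ _} {[]}    _  _           _           ()
cfVal-≤⊎loweringSwitch w {a ∷ A} {b ∷ B} tp (bin-a ∷ A₂) (bin-b ∷ B₂) |A|≡|B| with a ≟ b
... | no a≢b = deviate (a ≟ maxLetter (length w + 0))
  where
  b≡3∸a : b ≡ 3 ∸ a
  b≡3∸a = bin-other bin-a bin-b a≢b
  deviate : Dec (a ≡ maxLetter (length w + 0)) →
            cfVal (w ++ a ∷ A) ℚ.≤ cfVal (w ++ b ∷ B) ⊎ LoweringSwitch w (a ∷ A) (b ∷ B)
  deviate (yes a≡max) = inj₂ ([] , a , A , B , refl , cong (_∷ B) b≡3∸a , a≡max)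
  deviate (no a≢max)  = inj₁ (subst (λ x → cfVal (w ++ a ∷ A) ℚ.≤ cfVal (w ++ x ∷ B)) (sym b≡3∸a)
    (cfVal-raise w tp bin-a (a≢max ∘ subst (λ n → a ≡ maxLetter n) (sym (+-identityʳ (length w))))
      (bin-positive A₂) (bin-positive B₂)))
... | yes refl
  with cfVal-≤⊎loweringSwitch (w ++ a ∷ []) (tailPositive-∷ʳ w tp (bin-pos bin-a)) A₂ B₂ (suc-injective |A|≡|B|)
...   | inj₁ ≤ = inj₁ (subst₂ (λ x y → cfVal x ℚ.≤ cfVal y) (++-assoc w (a ∷ []) A) (++-assoc w (a ∷ []) B) ≤)
...   | inj₂ (u , c , v , v′ , eqA , eqB , c≡max) =
  inj₂ (a ∷ u , c , v , v′ , cong (a ∷_) eqA , cong (a ∷_) eqB ,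
        trans c≡max (cong maxLetter (trans (cong (_+ length u) (length-++ w)) (+-assoc (length w) 1 (length u)))))

PositiveSeq : Seq → Set
PositiveSeq X = ∀ i → 1 ≤ X i

fwd-length : ∀ X k m → length (fwd X k m) ≡ m
fwd-length X k zero    = refl
fwd-length X k (suc m) = cong suc (fwd-length X (ℤ.suc k) m)

bwd-length : ∀ X k m → length (bwd X k m) ≡ m
bwd-length X k zero    = refl
bwd-length X k (suc m) = cong suc (bwd-length X (ℤ.pred k) m)

fwd-all : ∀ {P : ℕ → Set} X → (∀ i → P (X i)) → ∀ k m → All P (fwd X k m)
fwd-all X p k zero    = []
fwd-all X p k (suc m) = p k ∷ fwd-all X p (ℤ.suc k) m

bwd-all : ∀ {P : ℕ → Set} X → (∀ i → P (X i)) → ∀ k m → All P (bwd X k m)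
bwd-all X p k zero    = []
bwd-all X p k (suc m) = p k ∷ bwd-all X p (ℤ.pred k) m

suc-+-pos : ∀ k m → ℤ.suc k ℤ.+ + m ≡ k ℤ.+ + suc m
suc-+-pos k m = trans (cong (ℤ._+ + m) (ℤ.+-comm ℤ.1ℤ k)) (ℤ.+-assoc k ℤ.1ℤ (+ m))

pred-−-pos : ∀ k m → ℤ.pred k ℤ.- + m ≡ k ℤ.- + suc m
pred-−-pos k m = trans (ℤ.pred-+ k (ℤ.- + m)) (sym (ℤ.minus-suc k m))

fwd-++ : ∀ X k m m′ → fwd X k (m + m′) ≡ fwd X k m ++ fwd X (k ℤ.+ + m) m′
fwd-++ X k zero    m′ = cong (λ i → fwd X i m′) (sym (ℤ.+-identityʳ k))
fwd-++ X k (suc m) m′ = cong (X k ∷_) (trans (fwd-++ X (ℤ.suc k) m m′)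
  (cong (λ i → fwd X (ℤ.suc k) m ++ fwd X i m′) (suc-+-pos k m)))

bwd-++ : ∀ X k m m′ → bwd X k (m + m′) ≡ bwd X k m ++ bwd X (k ℤ.- + m) m′
bwd-++ X k zero    m′ = cong (λ i → bwd X i m′) (sym (ℤ.+-identityʳ k))
bwd-++ X k (suc m) m′ = cong (X k ∷_) (trans (bwd-++ X (ℤ.pred k) m m′)
  (cong (λ i → bwd X (ℤ.pred k) m ++ bwd X i m′) (pred-−-pos k m)))

fwd-prefix : ∀ X k {m} u {v} → fwd X k m ≡ u ++ v → fwd X k (length u) ≡ u
fwd-prefix X k {m}     []      eq = refl
fwd-prefix X k {suc m} (x ∷ u) eq =
  cong₂ _∷_ (∷-injectiveˡ eq) (fwd-prefix X (ℤ.suc k) u (∷-injectiveʳ eq))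

bwd-prefix : ∀ X k {m} u {v} → bwd X k m ≡ u ++ v → bwd X k (length u) ≡ u
bwd-prefix X k {m}     []      eq = refl
bwd-prefix X k {suc m} (x ∷ u) eq =
  cong₂ _∷_ (∷-injectiveˡ eq) (bwd-prefix X (ℤ.pred k) u (∷-injectiveʳ eq))

fwd-lookup : ∀ X k {m} u {a v} → fwd X k m ≡ u ++ a ∷ v → X (k ℤ.+ + length u) ≡ a
fwd-lookup X k {suc m} []      eq = trans (cong X (ℤ.+-identityʳ k)) (∷-injectiveˡ eq)
fwd-lookup X k {suc m} (x ∷ u) eq =
  trans (cong X (sym (suc-+-pos k (length u)))) (fwd-lookup X (ℤ.suc k) u (∷-injectiveʳ eq))

bwd-lookup : ∀ X k {m} u {a v} → bwd X k m ≡ u ++ a ∷ v → X (k ℤ.- + length u) ≡ a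
bwd-lookup X k {suc m} []      eq = trans (cong X (ℤ.+-identityʳ k)) (∷-injectiveˡ eq)
bwd-lookup X k {suc m} (x ∷ u) eq =
  trans (cong X (sym (pred-−-pos k (length u)))) (bwd-lookup X (ℤ.pred k) u (∷-injectiveʳ eq))

module Convergents (a : ℕ) (f : ℕ → List ℕ) (f-positive : ∀ m → Positive (f m))
                   (f-length : ∀ m → length (f m) ≡ m) (f-++ : ∀ m m′ → ∃[ v ] f (m + m′) ≡ f m ++ v) where

  private
    extend≥ : ∀ m m′ → even m ≡ true → cfVal (a ∷ f m) ℚ.≤ cfVal (a ∷ f (m + m′))
    extend≥ m m′ ev with f-++ m m′
    ... | v , eq = subst (λ l → cfVal (a ∷ f m) ℚ.≤ cfVal (a ∷ l)) (sym eq)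
      (cfVal-even-convergent≤ a v (f-positive m) (++⁻ʳ (f m) (subst Positive eq (f-positive (m + m′))))
        (trans (cong even (f-length m)) ev))

    extend≤ : ∀ m m′ → even m ≡ false → cfVal (a ∷ f (m + m′)) ℚ.≤ cfVal (a ∷ f m)
    extend≤ m m′ ev with f-++ m m′
    ... | v , eq = subst (λ l → cfVal (a ∷ l) ℚ.≤ cfVal (a ∷ f m)) (sym eq)
      (cfVal-odd-convergent≥ a v (f-positive m) (++⁻ʳ (f m) (subst Positive eq (f-positive (m + m′))))
        (trans (cong even (f-length m)) ev))

  even-convergent-mono : ∀ {n n′} → n ≤ n′ → cfVal (a ∷ f (2 * n)) ℚ.≤ cfVal (a ∷ f (2 * n′))
  even-convergent-mono {n} {n′} n≤n′ =
    subst (λ m → cfVal (a ∷ f (2 * n)) ℚ.≤ cfVal (a ∷ f m)) 2n+2[n′∸n]≡2n′ (extend≥ (2 * n) _ (even-2* n))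
    where
    2n+2[n′∸n]≡2n′ : 2 * n + 2 * (n′ ∸ n) ≡ 2 * n′
    2n+2[n′∸n]≡2n′ = trans (sym (*-distribˡ-+ 2 n (n′ ∸ n))) (cong (2 *_) (m+[n∸m]≡n n≤n′))

  even≤odd-convergent : ∀ n e → cfVal (a ∷ f (2 * n)) ℚ.≤ cfVal (a ∷ f (suc (2 * e)))
  even≤odd-convergent n e = ℚ.≤-trans (extend≥ (2 * n) (suc (2 * e)) (even-2* n))
    (subst (λ m → cfVal (a ∷ f m) ℚ.≤ cfVal (a ∷ f (suc (2 * e)))) (+-comm (suc (2 * e)) (2 * n))
      (extend≤ (suc (2 * e)) (2 * n) (trans (even-suc (2 * e)) (cong not (even-2* e)))))

-- The odd convergents, which bound λ_k(X) from above.
upperApprox : Seq → ℤ → ℕ → ℚ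
upperApprox X k n = cfVal (fwd X k (2 + 2 * n)) ℚ.+ cfVal0 (bwd X (ℤ.pred k) (1 + 2 * n))

module _ {X : Seq} (pos : PositiveSeq X) (k : ℤ) where

  private
    module Right = Convergents (X k) (fwd X (ℤ.suc k)) (fwd-all X pos (ℤ.suc k)) (fwd-length X (ℤ.suc k))
                               (λ m m′ → _ , fwd-++ X (ℤ.suc k) m m′)
    module Left  = Convergents 0 (bwd X (ℤ.pred k)) (bwd-all X pos (ℤ.pred k)) (bwd-length X (ℤ.pred k))
                               (λ m m′ → _ , bwd-++ X (ℤ.pred k) m m′)

  lowerApprox-mono : ∀ {n n′} → n ≤ n′ → lowerApprox X k n ℚ.≤ lowerApprox X k n′
  lowerApprox-mono {n} {n′} n≤n′
    rewrite cfVal0-∷ (bwd X (ℤ.pred k) (2 * n)) | cfVal0-∷ (bwd X (ℤ.pred k) (2 * n′)) =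
    ℚ.+-mono-≤ (Right.even-convergent-mono n≤n′) (Left.even-convergent-mono n≤n′)

  lowerApprox≤upperApprox : ∀ n e → lowerApprox X k n ℚ.≤ upperApprox X k e
  lowerApprox≤upperApprox n e
    rewrite cfVal0-∷ (bwd X (ℤ.pred k) (2 * n)) | cfVal0-∷ (bwd X (ℤ.pred k) (1 + 2 * e)) =
    ℚ.+-mono-≤ (Right.even≤odd-convergent n e) (Left.even≤odd-convergent n e)

-- Windows and searches

record Window (B : Seq) (k : ℤ) (L R : List ℕ) : Set where
  constructor window
  field
    rightPart : fwd B k (length R) ≡ R
    leftPart  : bwd B (ℤ.pred k) (length L) ≡ L

window-shiftʳ : ∀ {B k L x R} → Window B k L (x ∷ R) → Window B (ℤ.suc k) (x ∷ L) R
window-shiftʳ {B} {k} {L} (window inʳ inˡ) = window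
  (∷-injectiveʳ inʳ)
  (subst (λ i → bwd B i (suc (length L)) ≡ _ ∷ L) (sym (ℤ.pred-suc k)) (cong₂ _∷_ (∷-injectiveˡ inʳ) inˡ))

window-shiftˡ : ∀ {B k x L R} → Window B k (x ∷ L) R → Window B (ℤ.pred k) L (x ∷ R)
window-shiftˡ {B} {k} {R = R} (window inʳ inˡ) = window
  (cong₂ _∷_ (∷-injectiveˡ inˡ) (subst (λ i → fwd B i (length R) ≡ R) (sym (ℤ.suc-pred k)) inʳ))
  (∷-injectiveʳ inˡ)

window-shiftʳ* : ∀ {B k L} u {R} → Window B k L (u ++ R) → Window B (k ℤ.+ + length u) (u ʳ++ L) R
window-shiftʳ* {B} {k} {L} [] {R} win = subst (λ i → Window B i L R) (sym (ℤ.+-identityʳ k)) win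
window-shiftʳ* {B} {k} {L} (x ∷ u) {R} win =
  subst (λ i → Window B i (u ʳ++ (x ∷ L)) R) (suc-+-pos k (length u)) (window-shiftʳ* u (window-shiftʳ win))

window-shiftˡ* : ∀ {B k} u {L R} → Window B k (u ++ L) R → Window B (k ℤ.- + length u) L (u ʳ++ R)
window-shiftˡ* {B} {k} [] {L} {R} win = subst (λ i → Window B i L R) (sym (ℤ.+-identityʳ k)) win
window-shiftˡ* {B} {k} (x ∷ u) {L} {R} win =
  subst (λ i → Window B i L (u ʳ++ (x ∷ R))) (pred-−-pos k (length u)) (window-shiftˡ* u (window-shiftˡ win))

window-++ʳ : ∀ {B k L R S} → Window B k L R → fwd B (k ℤ.+ + length R) (length S) ≡ S → Window B k L (R ++ S)
window-++ʳ {B} {k} {L} {R} {S} (window inʳ inˡ) inS = window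
  (trans (cong (fwd B k) (length-++ R)) (trans (fwd-++ B k (length R) (length S)) (cong₂ _++_ inʳ inS))) inˡ

window-++ˡ : ∀ {B k L R S} → Window B k L R → bwd B (ℤ.pred k ℤ.- + length L) (length S) ≡ S →
             Window B k (L ++ S) R
window-++ˡ {B} {k} {L} {R} {S} (window inʳ inˡ) inS = window inʳ
  (trans (cong (bwd B (ℤ.pred k)) (length-++ L))
         (trans (bwd-++ B (ℤ.pred k) (length L) (length S)) (cong₂ _++_ inˡ inS)))

window-extendʳ : ∀ {B k L R} → IsBinary12 B → Window B k L R → ∃[ x ] (Bin x × Window B k L (R ++ x ∷ []))
window-extendʳ {B} {k} {R = R} bin win = B (k ℤ.+ + length R) , bin _ , window-++ʳ win refl

window-extendˡ : ∀ {B k L R} → IsBinary12 B → Window B k L R → ∃[ x ] (Bin x × Window B k (L ++ x ∷ []) R)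
window-extendˡ {B} {k} {L} bin win = B (ℤ.pred k ℤ.- + length L) , bin _ , window-++ˡ win refl

window-forgetˡ : ∀ {B k L R} → Window B k L R → Window B k [] R
window-forgetˡ (window inʳ _) = window inʳ refl

window-forgetʳ : ∀ {B k L R} → Window B k L R → Window B k L []
window-forgetʳ (window _ inˡ) = window refl inˡ

positive⇒tailPositive : ∀ {w} → Positive w → TailPositive w
positive⇒tailPositive []        = []
positive⇒tailPositive (_ ∷ pos) = pos

windowBound : List ℕ → List ℕ → ℚ
windowBound L R = cfVal (R ++ minTail (length R) ∷ []) ℚ.+ cfVal (0 ∷ L ++ minTail (suc (length L)) ∷ [])

windowBound≤lowerApprox : ∀ {B k L R} → IsBinary12 B → Window B k L R →
                          windowBound L R ℚ.≤ lowerApprox B k (suc (length L + length R))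
windowBound≤lowerApprox {B} {k} {L} {R} bin (window inʳ inˡ)
  rewrite cfVal0-∷ (bwd B (ℤ.pred k) (2 * suc (length L + length R))) = ℚ.+-mono-≤ right left
  where
  l r : ℕ
  l = length L
  r = length R
  right-length : ∀ l r → suc (2 * suc (l + r)) ≡ r + suc (l + l + r + 2)
  right-length = solve-∀
  left-length : ∀ l r → 2 * suc (l + r) ≡ l + suc (l + r + r + 1)
  left-length = solve-∀
  right : cfVal (R ++ minTail r ∷ []) ℚ.≤ cfVal (fwd B k (suc (2 * suc (l + r))))
  right = subst (λ P → cfVal (R ++ minTail r ∷ []) ℚ.≤ cfVal P) (sym split)
    (cfVal-minTail≤ R (positive⇒tailPositive (subst Positive inʳ (bin-positive (fwd-all B bin k r))))
      (bin _) (bin-positive (fwd-all B bin _ _)))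
    where
    split : fwd B k (suc (2 * suc (l + r))) ≡ R ++ fwd B (k ℤ.+ + r) (suc (l + l + r + 2))
    split = trans (cong (fwd B k) (right-length l r))
                  (trans (fwd-++ B k r _) (cong (_++ fwd B (k ℤ.+ + r) (suc (l + l + r + 2))) inʳ))
  left : cfVal (0 ∷ L ++ minTail (suc l) ∷ []) ℚ.≤ cfVal (0 ∷ bwd B (ℤ.pred k) (2 * suc (l + r)))
  left = subst (λ P → cfVal (0 ∷ L ++ minTail (suc l) ∷ []) ℚ.≤ cfVal (0 ∷ P)) (sym split)
    (cfVal-minTail≤ (0 ∷ L) (subst Positive inˡ (bin-positive (bwd-all B bin (ℤ.pred k) l)))
      (bin _) (bin-positive (bwd-all B bin _ _)))
    where
    split : bwd B (ℤ.pred k) (2 * suc (l + r)) ≡ L ++ bwd B (ℤ.pred k ℤ.- + l) (suc (l + r + r + 1))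
    split = trans (cong (bwd B (ℤ.pred k)) (left-length l r))
                  (trans (bwd-++ B (ℤ.pred k) l _) (cong (_++ bwd B (ℤ.pred k ℤ.- + l) (suc (l + r + r + 1))) inˡ))

Exceeds : Seq → ℚ → Set
Exceeds B J = ∃[ k ] ∃[ n ] J ℚ.< lowerApprox B k n

exceedsAt : ℚ → List ℕ → List ℕ → Bool
exceedsAt J L R = ⌊ J ℚ.<? windowBound L R ⌋

scanʳ : ℚ → List ℕ → List ℕ → Bool
scanʳ J L []      = exceedsAt J L []
scanʳ J L (x ∷ R) = exceedsAt J L (x ∷ R) ∨ scanʳ J (x ∷ L) R

scanˡ : ℚ → List ℕ → List ℕ → Bool
scanˡ J []      R = exceedsAt J [] R
scanˡ J (x ∷ L) R = exceedsAt J (x ∷ L) R ∨ scanˡ J L (x ∷ R)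

exceedsAt-sound : ∀ {J B k L R} → IsBinary12 B → Window B k L R → T (exceedsAt J L R) → Exceeds B J
exceedsAt-sound {J} {k = k} {L} {R} bin win ok =
  k , suc (length L + length R) ,
  ℚ.<-≤-trans (toWitness {a? = J ℚ.<? windowBound L R} ok) (windowBound≤lowerApprox bin win)

scanʳ-sound : ∀ {J B k} L R → IsBinary12 B → Window B k L R → T (scanʳ J L R) → Exceeds B J
scanʳ-sound     L []      bin win ok = exceedsAt-sound bin win ok
scanʳ-sound {J} L (x ∷ R) bin win ok with Equivalence.to (T-∨ {exceedsAt J L (x ∷ R)}) ok
... | inj₁ here  = exceedsAt-sound bin win here
... | inj₂ later = scanʳ-sound (x ∷ L) R bin (window-shiftʳ win) later

scanˡ-sound : ∀ {J B k} L R → IsBinary12 B → Window B k L R → T (scanˡ J L R) → Exceeds B J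
scanˡ-sound     []      R bin win ok = exceedsAt-sound bin win ok
scanˡ-sound {J} (x ∷ L) R bin win ok with Equivalence.to (T-∨ {exceedsAt J (x ∷ L) R}) ok
... | inj₁ here  = exceedsAt-sound bin win here
... | inj₂ later = scanˡ-sound L (x ∷ R) bin (window-shiftˡ win) later

-- search is opaque: unfolding it on a window with unknown letters makes the type
-- checker expand huge numerals, so it is only ever evaluated on closed windows.
opaque
  search : ℚ → List ℕ → List ℕ → Bool
  search J L R = scanʳ J L R ∨ scanˡ J L R

  search-sound : ∀ {J B k L R} → IsBinary12 B → Window B k L R → search J L R ≡ true → Exceeds B J
  search-sound {J} {L = L} {R} bin win ok with Equivalence.to (T-∨ {scanʳ J L R}) (Equivalence.from T-≡ ok)
  ... | inj₁ ok′ = scanʳ-sound L R bin win ok′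
  ... | inj₂ ok′ = scanˡ-sound L R bin win ok′

data SearchTree : Set where
  exceeds stop    : SearchTree
  branchʳ branchˡ : SearchTree → SearchTree → SearchTree

module Explore (J : ℚ) {Goal : List ℕ → List ℕ → Set} (goal? : ∀ L R → Dec (Goal L R)) where

  valid : SearchTree → List ℕ → List ℕ → Bool
  valid exceeds         L R = search J L R
  valid stop            L R = ⌊ goal? L R ⌋
  valid (branchʳ t₁ t₂) L R = valid t₁ L (R ++ 1 ∷ []) ∧ valid t₂ L (R ++ 2 ∷ [])
  valid (branchˡ t₁ t₂) L R = valid t₁ (L ++ 1 ∷ []) R ∧ valid t₂ (L ++ 2 ∷ []) R

  explore : ∀ t {B k L R} → IsBinary12 B → Window B k L R → valid t L R ≡ true →
            Exceeds B J ⊎ ∃[ L′ ] ∃[ R′ ] (Goal L′ R′ × Window B k L′ R′)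
  explore exceeds bin win ok = inj₁ (search-sound bin win ok)
  explore stop {L = L} {R} bin win ok = inj₂ (L , R , toWitness {a? = goal? L R} (Equivalence.from T-≡ ok) , win)
  explore (branchʳ t₁ t₂) {L = L} {R} bin win ok
    with window-extendʳ bin win | Equivalence.to (T-∧ {valid t₁ L (R ++ 1 ∷ [])}) (Equivalence.from T-≡ ok)
  ... | _ , inj₁ refl , win′ | ok₁ , _ = explore t₁ bin win′ (Equivalence.to T-≡ ok₁)
  ... | _ , inj₂ refl , win′ | _ , ok₂ = explore t₂ bin win′ (Equivalence.to T-≡ ok₂)
  explore (branchˡ t₁ t₂) {L = L} {R} bin win ok
    with window-extendˡ bin win | Equivalence.to (T-∧ {valid t₁ (L ++ 1 ∷ []) R}) (Equivalence.from T-≡ ok)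
  ... | _ , inj₁ refl , win′ | ok₁ , _ = explore t₁ bin win′ (Equivalence.to T-≡ ok₁)
  ... | _ , inj₂ refl , win′ | _ , ok₂ = explore t₂ bin win′ (Equivalence.to T-≡ ok₂)

periodic-induction : ∀ {P : ℕ → Set} n₀ p .{{_ : NonZero p}} →
                     (∀ {m} → m < n₀ + p → P m) → (∀ m → P (n₀ + m) → P (n₀ + p + m)) → ∀ m → P m
periodic-induction {P} n₀ p base step = <-rec P induct
  where
  induct : ∀ m → (∀ {j} → j < m → P j) → P m
  induct m rec with m <? n₀ + p
  ... | yes m<n₀+p = base m<n₀+p
  ... | no  m≮n₀+p =
    subst P n₀+p+d≡m (step d (rec (subst (n₀ + d <_) n₀+p+d≡m (+-monoˡ-< d (m<m+n n₀ (>-nonZero⁻¹ p))))))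
    where
    d : ℕ
    d = m ∸ (n₀ + p)
    n₀+p+d≡m : n₀ + p + d ≡ m
    n₀+p+d≡m = m+[n∸m]≡n (≮⇒≥ m≮n₀+p)

lookup-all?-upTo : ∀ {P : ℕ → Set} (P? : ∀ m → Dec (P m)) n → True (All.all? P? (upTo n)) →
                   ∀ {m} → m < n → P m
lookup-all?-upTo P? n ok m<n = All.lookup (toWitness {a? = All.all? P? (upTo n)} ok) (∈-upTo⁺ m<n)

lookup-all-upTo : ∀ (p : ℕ → Bool) n → all p (upTo n) ≡ true → ∀ {m} → m < n → p m ≡ true
lookup-all-upTo p n ok m<n =
  Equivalence.to T-≡ (All.lookup (all⁺ p (upTo n) (Equivalence.from T-≡ ok)) (∈-upTo⁺ m<n))

guard-sound : ∀ {x y b} → x ≡ y → not (x ≡ᵇ y) ∨ b ≡ true → b ≡ true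
guard-sound {x} {y} x≡y ok with x ≡ᵇ y | ≡⇒≡ᵇ x y x≡y
... | true | _ = ok

bin? : ∀ x → Dec (Bin x)
bin? x = (x ≟ 1) ⊎-dec (x ≟ 2)

at-bin : ∀ {l} → All Bin l → ∀ {i} → i < length l → Bin (at l i)
at-bin (b ∷ _)  {zero}  _         = b
at-bin (_ ∷ bs) {suc i} (s≤s i<l) = at-bin bs i<l

middle-binary : All Bin middle
middle-binary = toWitness {a? = All.all? bin? middle} tt

leftBlock-binary : All Bin leftBlock
leftBlock-binary = toWitness {a? = All.all? bin? leftBlock} tt

rightBlock-binary : All Bin rightBlock
rightBlock-binary = toWitness {a? = All.all? bin? rightBlock} tt

jSeq-binary : IsBinary12 jSeq
jSeq-binary (+ n) with n <ᵇ 24 in n<24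
... | true  = at-bin middle-binary (+-monoˡ-< 3 (<ᵇ⇒< n 24 (subst T (sym n<24) tt)))
... | false = at-bin rightBlock-binary (m%n<n (n ∸ 24) 12)
jSeq-binary -[1+ n ] with n <ᵇ 3
... | true  = at-bin middle-binary (≤-<-trans (m∸n≤m 2 n) (s≤s (s≤s (s≤s z≤n))))
... | false = at-bin leftBlock-binary (s≤s (m∸n≤m 11 ((n ∸ 3) % 12)))

jSeq-positive : PositiveSeq jSeq
jSeq-positive = bin-pos ∘ jSeq-binary

jSeq-periodic⁺ : ∀ m → jSeq (+ (36 + m)) ≡ jSeq (+ (24 + m))
jSeq-periodic⁺ m = cong (at rightBlock) (trans (cong (_% 12) (+-comm 12 m)) ([m+n]%n≡m%n m 12))

jSeq-periodic⁻ : ∀ m → jSeq -[1+ 15 + m ] ≡ jSeq -[1+ 3 + m ]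
jSeq-periodic⁻ m = cong (λ i → at leftBlock (11 ∸ i)) (trans (cong (_% 12) (+-comm 12 m)) ([m+n]%n≡m%n m 12))

fwd-jSeq-periodic⁺ : ∀ m len → fwd jSeq (+ (36 + m)) len ≡ fwd jSeq (+ (24 + m)) len
fwd-jSeq-periodic⁺ m zero      = refl
fwd-jSeq-periodic⁺ m (suc len) = cong₂ _∷_ (jSeq-periodic⁺ m) (fwd-jSeq-periodic⁺ (suc m) len)

bwd-jSeq-periodic⁺ : ∀ m len → len ≤ suc m → bwd jSeq (+ (36 + m)) len ≡ bwd jSeq (+ (24 + m)) len
bwd-jSeq-periodic⁺ m       zero      _           = refl
bwd-jSeq-periodic⁺ zero    (suc len) (s≤s z≤n)   = cong (_∷ []) (jSeq-periodic⁺ 0)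
bwd-jSeq-periodic⁺ (suc m) (suc len) (s≤s len≤) = cong₂ _∷_ (jSeq-periodic⁺ (suc m)) (bwd-jSeq-periodic⁺ m len len≤)

fwd-jSeq-periodic⁻ : ∀ m len → len ≤ suc m → fwd jSeq -[1+ 15 + m ] len ≡ fwd jSeq -[1+ 3 + m ] len
fwd-jSeq-periodic⁻ m       zero      _           = refl
fwd-jSeq-periodic⁻ zero    (suc len) (s≤s z≤n)   = cong (_∷ []) (jSeq-periodic⁻ 0)
fwd-jSeq-periodic⁻ (suc m) (suc len) (s≤s len≤) = cong₂ _∷_ (jSeq-periodic⁻ (suc m)) (fwd-jSeq-periodic⁻ m len len≤)

bwd-jSeq-periodic⁻ : ∀ m len → bwd jSeq -[1+ 15 + m ] len ≡ bwd jSeq -[1+ 3 + m ] len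
bwd-jSeq-periodic⁻ m zero      = refl
bwd-jSeq-periodic⁻ m (suc len) = cong₂ _∷_ (jSeq-periodic⁻ m) (bwd-jSeq-periodic⁻ (suc m) len)

-- λ₀(jSeq) dominates: every other λ_k(jSeq) is bounded by an upper approximant that
-- lies below a lower approximant of λ₀; beyond the central part this repeats with period 12.
upperApprox-jSeq⁺<centre : ∀ j → upperApprox jSeq (+ suc j) 5 ℚ.< lowerApprox jSeq (+ 0) 12
upperApprox-jSeq⁺<centre =
  periodic-induction 34 12 (lookup-all?-upTo (λ j → upperApprox jSeq (+ suc j) 5 ℚ.<? centre) 46 _) step
  where
  centre : ℚ
  centre = lowerApprox jSeq (+ 0) 12
  step : ∀ m → upperApprox jSeq (+ suc (34 + m)) 5 ℚ.< centre → upperApprox jSeq (+ suc (46 + m)) 5 ℚ.< centre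
  step m = subst (ℚ._< centre) (sym (cong₂ (λ R L → cfVal R ℚ.+ cfVal0 L)
    (fwd-jSeq-periodic⁺ (suc (10 + m)) 12) (bwd-jSeq-periodic⁺ (10 + m) 11 (s≤s (m≤m+n 10 m)))))

upperApprox-jSeq⁻<centre : ∀ j → upperApprox jSeq -[1+ j ] 5 ℚ.< lowerApprox jSeq (+ 0) 12
upperApprox-jSeq⁻<centre =
  periodic-induction 14 12 (lookup-all?-upTo (λ j → upperApprox jSeq -[1+ j ] 5 ℚ.<? centre) 26 _) step
  where
  centre : ℚ
  centre = lowerApprox jSeq (+ 0) 12
  step : ∀ m → upperApprox jSeq -[1+ 14 + m ] 5 ℚ.< centre → upperApprox jSeq -[1+ 26 + m ] 5 ℚ.< centre
  step m = subst (ℚ._< centre) (sym (cong₂ (λ R L → cfVal R ℚ.+ cfVal0 L)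
    (fwd-jSeq-periodic⁻ (11 + m) 12 (s≤s (m≤m+n 11 m))) (bwd-jSeq-periodic⁻ (12 + m) 11)))

lowerApprox-jSeq≤centre : ∀ k n → lowerApprox jSeq k n ℚ.≤ lowerApprox jSeq (+ 0) (n + 12)
lowerApprox-jSeq≤centre (+ zero)  n = lowerApprox-mono jSeq-positive (+ 0) (m≤m+n n 12)
lowerApprox-jSeq≤centre (+ suc j) n = ℚ.≤-trans (lowerApprox≤upperApprox jSeq-positive (+ suc j) n 5)
  (ℚ.≤-trans (ℚ.<⇒≤ (upperApprox-jSeq⁺<centre j)) (lowerApprox-mono jSeq-positive (+ 0) (m≤n+m 12 n)))
lowerApprox-jSeq≤centre -[1+ j ]  n = ℚ.≤-trans (lowerApprox≤upperApprox jSeq-positive -[1+ j ] n 5)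
  (ℚ.≤-trans (ℚ.<⇒≤ (upperApprox-jSeq⁻<centre j)) (lowerApprox-mono jSeq-positive (+ 0) (m≤n+m 12 n)))

-- A rational upper bound for j₁ = m(jSeq); opaque for the same reason as search.
opaque
  j₁⁺ : ℚ
  j₁⁺ = upperApprox jSeq (+ 0) 20

  lowerApprox-jSeq≤j₁⁺ : ∀ k n → lowerApprox jSeq k n ℚ.≤ j₁⁺
  lowerApprox-jSeq≤j₁⁺ k n =
    ℚ.≤-trans (lowerApprox-jSeq≤centre k n) (lowerApprox≤upperApprox jSeq-positive (+ 0) (n + 12) 20)

markovLess⇒¬exceeds : ∀ {B} → MarkovLess B jSeq → ¬ Exceeds B j₁⁺
markovLess⇒¬exceeds (q , bounded , k₀ , n₀ , q<) (k , n , j₁⁺<) = ℚ.<-irrefl refl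
  (ℚ.<-≤-trans (ℚ.≤-<-trans (bounded k n) q<) (ℚ.≤-trans (lowerApprox-jSeq≤j₁⁺ k₀ n₀) (ℚ.<⇒≤ j₁⁺<)))

-- Switching one letter of jSeq

centreˡ centreʳ : List ℕ
centreˡ = bwd jSeq -[1+ 0 ] 12
centreʳ = fwd jSeq (+ 0) 12

switchʳ : ℕ → List ℕ
switchʳ p = fwd jSeq (+ 0) p ++ (3 ∸ jSeq (+ p)) ∷ []

switchˡ : ℕ → List ℕ
switchˡ p = bwd jSeq -[1+ 0 ] p ++ (3 ∸ jSeq -[1+ p ]) ∷ []

-- Far from the centre only the last 30 letters before the switch are needed, and
-- these repeat with period 12.
tailʳ : ℕ → List ℕ
tailʳ m = fwd jSeq (+ (36 + m)) 30 ++ (3 ∸ jSeq (+ (66 + m))) ∷ []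

tailˡ : ℕ → List ℕ
tailˡ m = bwd jSeq -[1+ 36 + m ] 30 ++ (3 ∸ jSeq -[1+ 66 + m ]) ∷ []

FarSearchʳ : ℕ → Set
FarSearchʳ m = jSeq (+ (66 + m)) ≡ maxLetter (66 + m) → search j₁⁺ [] (tailʳ m) ≡ true

FarSearchˡ : ℕ → Set
FarSearchˡ m = jSeq -[1+ 66 + m ] ≡ maxLetter (67 + m) → search j₁⁺ (tailˡ m) [] ≡ true

nearCheckʳ nearCheckˡ farCheckʳ farCheckˡ : ℕ → Bool
nearCheckʳ p = not (jSeq (+ p) ≡ᵇ maxLetter p) ∨ search j₁⁺ centreˡ (switchʳ p)
nearCheckˡ p = not (jSeq -[1+ p ] ≡ᵇ maxLetter (suc p)) ∨ search j₁⁺ (switchˡ p) centreʳ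
farCheckʳ  m = not (jSeq (+ (66 + m)) ≡ᵇ maxLetter (66 + m)) ∨ search j₁⁺ [] (tailʳ m)
farCheckˡ  m = not (jSeq -[1+ 66 + m ] ≡ᵇ maxLetter (67 + m)) ∨ search j₁⁺ (tailˡ m) []

opaque
  unfolding search j₁⁺

  near-tableʳ : all (λ i → nearCheckʳ (12 + i)) (upTo 54) ≡ true
  near-tableʳ = refl

  near-tableˡ : all (λ i → nearCheckˡ (12 + i)) (upTo 54) ≡ true
  near-tableˡ = refl

  far-tableʳ : all farCheckʳ (upTo 12) ≡ true
  far-tableʳ = refl

  far-tableˡ : all farCheckˡ (upTo 12) ≡ true
  far-tableˡ = refl

near-searchʳ : ∀ {i} → i < 54 → jSeq (+ (12 + i)) ≡ maxLetter (12 + i) →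
                search j₁⁺ centreˡ (switchʳ (12 + i)) ≡ true
near-searchʳ i<54 max = guard-sound max (lookup-all-upTo (λ i → nearCheckʳ (12 + i)) 54 near-tableʳ i<54)

near-searchˡ : ∀ {i} → i < 54 → jSeq -[1+ 12 + i ] ≡ maxLetter (13 + i) →
                search j₁⁺ (switchˡ (12 + i)) centreʳ ≡ true
near-searchˡ i<54 max = guard-sound max (lookup-all-upTo (λ i → nearCheckˡ (12 + i)) 54 near-tableˡ i<54)

far-searchʳ : ∀ m → FarSearchʳ m
far-searchʳ =
  periodic-induction 0 12 (λ m<12 max → guard-sound max (lookup-all-upTo farCheckʳ 12 far-tableʳ m<12)) step
  where
  step : ∀ m → FarSearchʳ m → FarSearchʳ (12 + m)
  step m far max =
    subst (λ W → search j₁⁺ [] W ≡ true) (sym tail-periodic) (far (trans (sym (jSeq-periodic⁺ (42 + m))) max))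
    where
    tail-periodic : tailʳ (12 + m) ≡ tailʳ m
    tail-periodic = cong₂ (λ W x → W ++ (3 ∸ x) ∷ []) (fwd-jSeq-periodic⁺ (12 + m) 30) (jSeq-periodic⁺ (42 + m))

far-searchˡ : ∀ m → FarSearchˡ m
far-searchˡ =
  periodic-induction 0 12 (λ m<12 max → guard-sound max (lookup-all-upTo farCheckˡ 12 far-tableˡ m<12)) step
  where
  step : ∀ m → FarSearchˡ m → FarSearchˡ (12 + m)
  step m far max =
    subst (λ W → search j₁⁺ W [] ≡ true) (sym tail-periodic) (far (trans (sym (jSeq-periodic⁻ (63 + m))) max))
    where
    tail-periodic : tailˡ (12 + m) ≡ tailˡ m
    tail-periodic = cong₂ (λ W x → W ++ (3 ∸ x) ∷ []) (bwd-jSeq-periodic⁻ (33 + m) 30) (jSeq-periodic⁻ (63 + m))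

66+m≡36+m+30 : ∀ m → 66 + m ≡ 36 + m + 30
66+m≡36+m+30 m = sym (trans (+-assoc 36 m 30) (cong (λ x → 36 + x) (+-comm m 30)))

switchʳ-split : ∀ m → switchʳ (66 + m) ≡ fwd jSeq (+ 0) (36 + m) ++ tailʳ m
switchʳ-split m =
  trans (cong (_++ (3 ∸ jSeq (+ (66 + m))) ∷ [])
          (trans (cong (fwd jSeq (+ 0)) (66+m≡36+m+30 m)) (fwd-++ jSeq (+ 0) (36 + m) 30)))
        (++-assoc (fwd jSeq (+ 0) (36 + m)) (fwd jSeq (+ (36 + m)) 30) ((3 ∸ jSeq (+ (66 + m))) ∷ []))

switchˡ-split : ∀ m → switchˡ (66 + m) ≡ bwd jSeq -[1+ 0 ] (36 + m) ++ tailˡ m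
switchˡ-split m =
  trans (cong (_++ (3 ∸ jSeq -[1+ 66 + m ]) ∷ [])
          (trans (cong (bwd jSeq -[1+ 0 ]) (66+m≡36+m+30 m)) (bwd-++ jSeq -[1+ 0 ] (36 + m) 30)))
        (++-assoc (bwd jSeq -[1+ 0 ] (36 + m)) (bwd jSeq -[1+ 36 + m ] 30) ((3 ∸ jSeq -[1+ 66 + m ]) ∷ []))

far-exceedsʳ : ∀ {B} m → IsBinary12 B → jSeq (+ (66 + m)) ≡ maxLetter (66 + m) →
               Window B (+ 0) centreˡ (switchʳ (66 + m)) → Exceeds B j₁⁺
far-exceedsʳ {B} m bin max win = search-sound {j₁⁺} bin (window-forgetˡ shifted) (far-searchʳ m max)
  where
  shifted : Window B (+ 0 ℤ.+ + length (fwd jSeq (+ 0) (36 + m))) (fwd jSeq (+ 0) (36 + m) ʳ++ centreˡ) (tailʳ m)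
  shifted = window-shiftʳ* (fwd jSeq (+ 0) (36 + m)) (subst (Window B (+ 0) centreˡ) (switchʳ-split m) win)

far-exceedsˡ : ∀ {B} m → IsBinary12 B → jSeq -[1+ 66 + m ] ≡ maxLetter (67 + m) →
               Window B (+ 0) (switchˡ (66 + m)) centreʳ → Exceeds B j₁⁺
far-exceedsˡ {B} m bin max win = search-sound {j₁⁺} bin (window-forgetʳ shifted) (far-searchˡ m max)
  where
  shifted : Window B (+ 0 ℤ.- + length (bwd jSeq -[1+ 0 ] (36 + m))) (tailˡ m) (bwd jSeq -[1+ 0 ] (36 + m) ʳ++ centreʳ)
  shifted = window-shiftˡ* (bwd jSeq -[1+ 0 ] (36 + m)) (subst (λ L → Window B (+ 0) L centreʳ) (switchˡ-split m) win)

switch-exceedsʳ : ∀ {B} i → IsBinary12 B → jSeq (+ (12 + i)) ≡ maxLetter (12 + i) →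
                  Window B (+ 0) centreˡ (switchʳ (12 + i)) → Exceeds B j₁⁺
switch-exceedsʳ {B} i bin max win with i <? 54
... | yes i<54 = search-sound {j₁⁺} bin win (near-searchʳ i<54 max)
... | no  i≮54 = far-exceedsʳ (i ∸ 54) bin (subst Max i≡54+d max) (subst Switched i≡54+d win)
  where
  i≡54+d : i ≡ 54 + (i ∸ 54)
  i≡54+d = sym (m+[n∸m]≡n (≮⇒≥ i≮54))
  Max Switched : ℕ → Set
  Max      n = jSeq (+ (12 + n)) ≡ maxLetter (12 + n)
  Switched n = Window B (+ 0) centreˡ (switchʳ (12 + n))

switch-exceedsˡ : ∀ {B} i → IsBinary12 B → jSeq -[1+ 12 + i ] ≡ maxLetter (13 + i) →
                  Window B (+ 0) (switchˡ (12 + i)) centreʳ → Exceeds B j₁⁺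
switch-exceedsˡ {B} i bin max win with i <? 54
... | yes i<54 = search-sound {j₁⁺} bin win (near-searchˡ i<54 max)
... | no  i≮54 = far-exceedsˡ (i ∸ 54) bin (subst Max i≡54+d max) (subst Switched i≡54+d win)
  where
  i≡54+d : i ≡ 54 + (i ∸ 54)
  i≡54+d = sym (m+[n∸m]≡n (≮⇒≥ i≮54))
  Max Switched : ℕ → Set
  Max      n = jSeq -[1+ 12 + n ] ≡ maxLetter (13 + n)
  Switched n = Window B (+ 0) (switchˡ (12 + n)) centreʳ

negsuc-−-pos : ∀ j n → -[1+ j ] ℤ.- + n ≡ -[1+ j + n ]
negsuc-−-pos j zero    = trans (ℤ.+-identityʳ -[1+ j ]) (cong -[1+_] (sym (+-identityʳ j)))
negsuc-−-pos j (suc n) = cong -[1+_] (sym (+-suc j n))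

right-≤⊎exceeds : ∀ {B} → IsBinary12 B → Window B (+ 0) centreˡ centreʳ → ∀ r →
             cfVal (fwd jSeq (+ 0) (12 + r)) ℚ.≤ cfVal (fwd B (+ 0) (12 + r)) ⊎ Exceeds B j₁⁺
right-≤⊎exceeds {B} bin win r
  with cfVal-≤⊎loweringSwitch centreʳ (positive⇒tailPositive (fwd-all jSeq jSeq-positive (+ 0) 12))
         (fwd-all jSeq jSeq-binary (+ 12) r) (fwd-all B bin (+ 12) r)
         (trans (fwd-length jSeq (+ 12) r) (sym (fwd-length B (+ 12) r)))
... | inj₁ ≤ = inj₁ (subst₂ (λ J X → cfVal J ℚ.≤ cfVal X) (sym (fwd-++ jSeq (+ 0) 12 r)) (sym B-split) ≤)
  where
  B-split : fwd B (+ 0) (12 + r) ≡ centreʳ ++ fwd B (+ 12) r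
  B-split = trans (fwd-++ B (+ 0) 12 r) (cong (_++ fwd B (+ 12) r) (Window.rightPart win))
... | inj₂ (u , a , v , v′ , eqJ , eqB , a≡max) =
  inj₂ (switch-exceedsʳ (length u) bin (trans a≡jSeq a≡max)
          (subst (Window B (+ 0) centreˡ) (sym switch-split) win′))
  where
  a≡jSeq : jSeq (+ (12 + length u)) ≡ a
  a≡jSeq = fwd-lookup jSeq (+ 12) u eqJ
  win′ : Window B (+ 0) centreˡ (centreʳ ++ u ++ (3 ∸ a) ∷ [])
  win′ = window-++ʳ win (fwd-prefix B (+ 12) (u ++ (3 ∸ a) ∷ []) (trans eqB (sym (++-assoc u _ v′))))
  switch-split : switchʳ (12 + length u) ≡ centreʳ ++ u ++ (3 ∸ a) ∷ []
  switch-split = trans (cong₂ (λ W x → W ++ (3 ∸ x) ∷ [])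
                         (trans (fwd-++ jSeq (+ 0) 12 (length u)) (cong (centreʳ ++_) (fwd-prefix jSeq (+ 12) u eqJ)))
                         a≡jSeq)
                       (++-assoc centreʳ u _)

left-≤⊎exceeds : ∀ {B} → IsBinary12 B → Window B (+ 0) centreˡ centreʳ → ∀ r →
             cfVal0 (bwd jSeq -[1+ 0 ] (12 + r)) ℚ.≤ cfVal0 (bwd B -[1+ 0 ] (12 + r)) ⊎ Exceeds B j₁⁺
left-≤⊎exceeds {B} bin win r rewrite cfVal0-∷ (bwd jSeq -[1+ 0 ] (12 + r)) | cfVal0-∷ (bwd B -[1+ 0 ] (12 + r))
  with cfVal-≤⊎loweringSwitch (0 ∷ centreˡ) (bwd-all jSeq jSeq-positive -[1+ 0 ] 12)
         (bwd-all jSeq jSeq-binary -[1+ 12 ] r) (bwd-all B bin -[1+ 12 ] r)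
         (trans (bwd-length jSeq -[1+ 12 ] r) (sym (bwd-length B -[1+ 12 ] r)))
... | inj₁ ≤ =
  inj₁ (subst₂ (λ J X → cfVal (0 ∷ J) ℚ.≤ cfVal (0 ∷ X)) (sym (bwd-++ jSeq -[1+ 0 ] 12 r)) (sym B-split) ≤)
  where
  B-split : bwd B -[1+ 0 ] (12 + r) ≡ centreˡ ++ bwd B -[1+ 12 ] r
  B-split = trans (bwd-++ B -[1+ 0 ] 12 r) (cong (_++ bwd B -[1+ 12 ] r) (Window.leftPart win))
... | inj₂ (u , a , v , v′ , eqJ , eqB , a≡max) =
  inj₂ (switch-exceedsˡ (length u) bin (trans a≡jSeq a≡max)
          (subst (λ L → Window B (+ 0) L centreʳ) (sym switch-split) win′))
  where
  a≡jSeq : jSeq -[1+ 12 + length u ] ≡ a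
  a≡jSeq = trans (cong jSeq (sym (negsuc-−-pos 12 (length u)))) (bwd-lookup jSeq -[1+ 12 ] u eqJ)
  win′ : Window B (+ 0) (centreˡ ++ u ++ (3 ∸ a) ∷ []) centreʳ
  win′ = window-++ˡ win (bwd-prefix B -[1+ 12 ] (u ++ (3 ∸ a) ∷ []) (trans eqB (sym (++-assoc u _ v′))))
  switch-split : switchˡ (12 + length u) ≡ centreˡ ++ u ++ (3 ∸ a) ∷ []
  switch-split = trans (cong₂ (λ W x → W ++ (3 ∸ x) ∷ [])
                         (trans (bwd-++ jSeq -[1+ 0 ] 12 (length u)) (cong (centreˡ ++_) (bwd-prefix jSeq -[1+ 12 ] u eqJ)))
                         a≡jSeq)
                       (++-assoc centreˡ u _)

centre-dominated : ∀ {B} → IsBinary12 B → Window B (+ 0) centreˡ centreʳ → ∀ n →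
                   lowerApprox jSeq (+ 0) (n + 12) ℚ.≤ lowerApprox B (+ 0) (n + 12) ⊎ Exceeds B j₁⁺
centre-dominated {B} bin win n with right-≤⊎exceeds bin win (suc (2 * n + 12)) | left-≤⊎exceeds bin win (2 * n + 12)
... | inj₂ e | _      = inj₂ e
... | inj₁ _ | inj₂ e = inj₂ e
... | inj₁ r | inj₁ l = inj₁ (subst (λ m → cfVal (fwd jSeq (+ 0) (suc m)) ℚ.+ cfVal0 (bwd jSeq -[1+ 0 ] m)
                                           ℚ.≤ cfVal (fwd B (+ 0) (suc m)) ℚ.+ cfVal0 (bwd B -[1+ 0 ] m))
                                      (sym (2[n+12]≡12+[2n+12] n)) (ℚ.+-mono-≤ r l))
  where
  2[n+12]≡12+[2n+12] : ∀ n → 2 * (n + 12) ≡ 12 + (2 * n + 12)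
  2[n+12]≡12+[2n+12] = solve-∀

centre-window-impossible : ∀ {B} → MarkovLess B jSeq → IsBinary12 B → ¬ Window B (+ 0) centreˡ centreʳ
centre-window-impossible less@(q , bounded , k₀ , n₀ , q<) bin win with centre-dominated bin win n₀
... | inj₂ e  = markovLess⇒¬exceeds less e
... | inj₁ le = ℚ.<-irrefl refl (ℚ.≤-<-trans
  (ℚ.≤-trans (lowerApprox-jSeq≤centre k₀ n₀) (ℚ.≤-trans le (bounded (+ 0) (n₀ + 12)))) q<)

-- The case analysis

-- 22 w w* w 1 around position 0: targetˡ lists b₋₁, …, b₋₁₂ and targetʳ lists b₀, …, b₁₁.
targetˡ targetʳ : List ℕ
targetˡ = 1 ∷ 1 ∷ 1 ∷ 2 ∷ 2 ∷ 1 ∷ 2 ∷ 1 ∷ 1 ∷ 1 ∷ 2 ∷ 2 ∷ []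
targetʳ = 2 ∷ 1 ∷ 2 ∷ 2 ∷ 1 ∷ 1 ∷ 1 ∷ 2 ∷ 1 ∷ 2 ∷ 2 ∷ 1 ∷ []

Outcome : List ℕ → List ℕ → Set
Outcome L R = (L ≡ targetˡ × R ≡ targetʳ) ⊎ (L ≡ centreˡ × R ≡ centreʳ)

outcome? : ∀ L R → Dec (Outcome L R)
outcome? L R = (L ≟ₗ targetˡ ×-dec R ≟ₗ targetʳ) ⊎-dec (L ≟ₗ centreˡ ×-dec R ≟ₗ centreʳ)
  where
  _≟ₗ_ : DecidableEquality (List ℕ)
  _≟ₗ_ = ≡-dec _≟_

searchTree : SearchTree
searchTree =
  branchˡ (branchʳ (branchˡ exceeds (branchʳ exceeds (branchˡ (branchˡ (branchʳ (branchʳ (branchˡ exceeds exceeds)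
    (branchʳ exceeds (branchˡ (branchʳ (branchˡ (branchˡ stop exceeds) (branchˡ exceeds stop)) exceeds) exceeds)))
    exceeds) exceeds) (branchʳ exceeds exceeds)))) exceeds) exceeds

opaque
  unfolding search j₁⁺

  searchTree-valid :
    Explore.valid j₁⁺ outcome? searchTree (1 ∷ 1 ∷ 1 ∷ 2 ∷ 2 ∷ []) (2 ∷ 1 ∷ 2 ∷ 2 ∷ 1 ∷ 1 ∷ []) ≡ true
  searchTree-valid = refl

matches⇒fwd : ∀ {B} u s → matchesFrom B u s → fwd B s (length u) ≡ u
matches⇒fwd []      s _          = refl
matches⇒fwd (a ∷ u) s (b≡a , bs) = cong₂ _∷_ b≡a (matches⇒fwd u (ℤ.suc s) bs)

fwd⇒matches : ∀ {B} u s → fwd B s (length u) ≡ u → matchesFrom B u s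
fwd⇒matches []      s _  = tt
fwd⇒matches (a ∷ u) s eq = ∷-injectiveˡ eq , fwd⇒matches u (ℤ.suc s) (∷-injectiveʳ eq)

mainTheorem18 : (B : Seq) → IsBinary12 B
    → matchesFrom B (2 ∷ 2 ∷ (w ++ (1 ∷ 1 ∷ []))) (- (+ 5))
    → MarkovLess B jSeq
    → matchesFrom B (2 ∷ 2 ∷ (w ++ (w ++ (w ++ (1 ∷ []))))) (- (+ 12))
mainTheorem18 B bin given less = conclude (Explore.explore j₁⁺ outcome? searchTree bin start searchTree-valid)
  where
  start : Window B (+ 0) (1 ∷ 1 ∷ 1 ∷ 2 ∷ 2 ∷ []) (2 ∷ 1 ∷ 2 ∷ 2 ∷ 1 ∷ 1 ∷ [])
  start = window-shiftʳ* (2 ∷ 2 ∷ 1 ∷ 1 ∷ 1 ∷ [])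
            (window (matches⇒fwd {B} (2 ∷ 2 ∷ (w ++ (1 ∷ 1 ∷ []))) (- (+ 5)) given) refl)
  conclude : Exceeds B j₁⁺ ⊎ ∃[ L ] ∃[ R ] (Outcome L R × Window B (+ 0) L R) →
             matchesFrom B (2 ∷ 2 ∷ (w ++ (w ++ (w ++ (1 ∷ []))))) (- (+ 12))
  conclude (inj₁ exceeds-j₁⁺)                      = ⊥-elim (markovLess⇒¬exceeds less exceeds-j₁⁺)
  conclude (inj₂ (_ , _ , inj₁ (refl , refl) , win)) =
    fwd⇒matches {B} (2 ∷ 2 ∷ (w ++ (w ++ (w ++ (1 ∷ []))))) (- (+ 12)) (Window.rightPart (window-shiftˡ* targetˡ win))
  conclude (inj₂ (_ , _ , inj₂ (refl , refl) , win)) = ⊥-elim (centre-window-impossible less bin win)
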